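{- The logic $L$ is complete with respect to the class of all PN-frames: if a formula $\varphi$ is forced at every world of every PN-model, then $\varphi$ is a theorem of $L$.
   Context: Formulas are built from a fixed denumerable set $PV$ of propositional variables and the constant $\bot$ using $\land, \lor, \rightarrow$ and the unary operator $\Box$ ($\lnot\varphi$ abbreviates $\varphi \rightarrow \bot$). The logic $L$ is the smallest set of formulas containing all instances (in this modal language) of the axiom schemes of intuitionistic propositional logic and all instances of $\Box \varphi \rightarrow \varphi$, and closed under modus ponens and the extensionality rule (from $\varphi \leftrightarrow \psi$ infer $\Box \varphi \leftrightarrow \Box \psi$). A PN-frame is a triple $\langle W, \mathcal{N}, \leq \rangle$ where $\leq$ is a partial order on $W$ and $\mathcal{N}: W \to P(P(W))$ satisfies: whenever $w \leq v$, $v \in X \subseteq W$ and $X \in \mathcal{N}_w$, then $X \in \mathcal{N}_v$. A PN-model adds a valuation $V: PV \to P(W)$ with $w \in V(q)$, $w \leq v$ implying $v \in V(q)$. Forcing: $w \nVdash \bot$; $w \Vdash q$ iff $w \in V(q)$; $\lor, \land$ pointwise; $w \Vdash \varphi \rightarrow \psi$ iff for every $v \geq w$, $v \nVdash \varphi$ or $v \Vdash \psi$; $w \Vdash \Box \varphi$ iff $w \Vdash \varphi$ and $\{z \in W : z \Vdash \varphi\} \in \mathcal{N}_w$. -}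

module Defs where

open import Data.Nat using (ℕ)
open import Data.Product using (_×_; Σ)
open import Data.Sum using (_⊎_)
open import Data.Empty using (⊥)
open import Relation.Binary.PropositionalEquality using (_≡_)
open import Relation.Binary.Structures using (IsPartialOrder)

PV : Set
PV = ℕ

infixr 6 _∧'_
infixr 5 _∨'_
infixr 4 _⇒_

data Form : Set where
  var  : PV → Form
  ⊥'   : Form
  _∧'_ : Form → Form → Form
  _∨'_ : Form → Form → Form
  _⇒_  : Form → Form → Form
  □    : Form → Form

¬' : Form → Form
¬' φ = φ ⇒ ⊥'

_⇔_ : Form → Form → Form
φ ⇔ ψ = (φ ⇒ ψ) ∧' (ψ ⇒ φ)

data L : Form → Set where
  ax-K    : ∀ φ ψ → L (φ ⇒ ψ ⇒ φ)
  ax-S    : ∀ φ ψ χ → L ((φ ⇒ ψ ⇒ χ) ⇒ (φ ⇒ ψ) ⇒ φ ⇒ χ)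
  ax-∧E₁  : ∀ φ ψ → L (φ ∧' ψ ⇒ φ)
  ax-∧E₂  : ∀ φ ψ → L (φ ∧' ψ ⇒ ψ)
  ax-∧I   : ∀ φ ψ → L (φ ⇒ ψ ⇒ φ ∧' ψ)
  ax-∨I₁  : ∀ φ ψ → L (φ ⇒ φ ∨' ψ)
  ax-∨I₂  : ∀ φ ψ → L (ψ ⇒ φ ∨' ψ)
  ax-∨E   : ∀ φ ψ χ → L ((φ ⇒ χ) ⇒ (ψ ⇒ χ) ⇒ φ ∨' ψ ⇒ χ)
  ax-⊥E   : ∀ φ → L (⊥' ⇒ φ)
  ax-T    : ∀ φ → L (□ φ ⇒ φ)
  mp      : ∀ {φ ψ} → L (φ ⇒ ψ) → L φ → L ψ
  ext     : ∀ {φ ψ} → L (φ ⇔ ψ) → L (□ φ ⇔ □ ψ)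

-- Subsets of W are predicates W → Set; "X ∈ N w" is N w X.
record PNFrame : Set₁ where
  field
    W    : Set
    N    : W → (W → Set) → Set
    _≤_  : W → W → Set
    isPO : IsPartialOrder _≡_ _≤_
    -- N w is a family of *sets*: it respects extensional equality of subsets
    N-ext : ∀ {w} {X Y : W → Set} →
            (∀ z → X z → Y z) → (∀ z → Y z → X z) → N w X → N w Y
    N-mono : ∀ {w v} {X : W → Set} → w ≤ v → X v → N w X → N v X

record PNModel : Set₁ where
  field
    frame : PNFrame
  open PNFrame frame public
  field
    V      : PV → W → Set
    V-mono : ∀ {q w v} → V q w → w ≤ v → V q v

module _ (M : PNModel) where
  open PNModel M

  _⊩_ : W → Form → Set
  w ⊩ var q    = V q w
  w ⊩ ⊥'       = ⊥
  w ⊩ (φ ∧' ψ) = (w ⊩ φ) × (w ⊩ ψ)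
  w ⊩ (φ ∨' ψ) = (w ⊩ φ) ⊎ (w ⊩ ψ)
  w ⊩ (φ ⇒ ψ)  = ∀ v → w ≤ v → (v ⊩ φ) → (v ⊩ ψ)
  w ⊩ □ φ      = (w ⊩ φ) × N w (λ z → z ⊩ φ)

PN-valid : Form → Set₁
PN-valid φ = ∀ (M : PNModel) (w : PNModel.W M) → _⊩_ M w φ

-- Finite canonical model over the subformulas Σ of φ.  Worlds are the Boolean valuations
-- of Σ; a valuation is inconsistent when the formulas it makes true derive in L the
-- disjunction of those it makes false.  Starting from all valuations, we keep discarding one
-- that violates a local saturation condition relative to the remaining family; each violation
-- is turned into a derivation showing that the discarded valuation is inconsistent.  For □
-- this is where extensionality enters: formulas true at exactly the same remaining worlds are
-- provably equivalent, because every valuation outside the family is inconsistent.  The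
-- survivors carry a PN-model in which forcing coincides with membership, and a formula true
-- at every survivor is derivable, again because all other valuations are inconsistent.
module Submission where

open import Defs
open import Data.Bool as Bool using (Bool; true; false; _∧_; _∨_; b≤b; f≤t; if_then_else_)
import Data.Bool.Properties as Bool
open import Data.Empty using (⊥-elim)
open import Data.List using (List; []; _∷_; _++_; length; filter; cartesianProductWith)
open import Data.List.Membership.Propositional using (_∈_; _∉_; find; lose)
import Data.List.Membership.DecPropositional as DecMembership
open import Data.List.Membership.Propositional.Properties using (∈-++⁺ˡ; ∈-++⁺ʳ; ∈-++⁻; ∈-cartesianProductWith⁺; ∈-filter⁺)
open import Data.List.Relation.Binary.Permutation.Propositional using (_↭_; ↭-sym)
open import Data.List.Relation.Binary.Permutation.Propositional.Properties using (∈-resp-↭; shift; ++-comm)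
open import Data.List.Relation.Binary.Subset.Propositional using (_⊆_)
open import Data.List.Relation.Unary.All as All using (All; []; _∷_)
open import Data.List.Relation.Unary.Any as Any using (Any; here; there)
open import Data.List.Properties using (filter-notAll)
open import Data.Nat as ℕ using (ℕ; zero; suc; _≤_; s≤s⁻¹)
open import Data.Nat.Properties using (≤-refl; ≤-trans)
open import Data.Product using (_×_; _,_; proj₁; proj₂; uncurry; ∃-syntax)
open import Data.Sum as Sum using (_⊎_; inj₁; inj₂)
open import Data.Unit using (⊤; tt)
open import Data.Vec using (Vec; []; _∷_; replicate)
import Data.Vec.Properties as Vec
open import Data.Vec.Relation.Binary.Pointwise.Inductive as Pointwise using (Pointwise; []; _∷_)
open import Function using (_∘_)
open import Function.Bundles using (mk⇔)
open import Relation.Binary.Definitions using (DecidableEquality)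
open import Relation.Binary.Structures using (IsPartialOrder)
import Relation.Binary.PropositionalEquality as ≡
open import Relation.Binary.PropositionalEquality using (_≡_; refl; sym; trans; cong; cong₂; subst)
open import Relation.Nullary using (Dec; yes; no; ¬_; ⌊_⌋)
open import Relation.Nullary.Decidable using (map′; _×-dec_; ¬?)

all-or-any : ∀ {A : Set} {P Q : A → Set} xs → (∀ {x} → x ∈ xs → P x ⊎ Q x) → All P xs ⊎ Any Q xs
all-or-any []       decide = inj₁ []
all-or-any (x ∷ xs) decide with decide (here refl) | all-or-any xs (decide ∘ there)
... | inj₂ q | _        = inj₂ (here q)
... | inj₁ p | inj₁ ps  = inj₁ (p ∷ ps)
... | inj₁ p | inj₂ qs  = inj₂ (there qs)

all-or-failure : ∀ {A J : Set} {P : A → Set} xs → (∀ {x} → x ∈ xs → P x ⊎ J) → All P xs ⊎ J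
all-or-failure xs decide with all-or-any xs decide
... | inj₁ all  = inj₁ all
... | inj₂ some = inj₂ (proj₂ (Any.satisfied some))

both-or-failure : ∀ {P Q J : Set} → P ⊎ J → Q ⊎ J → (P × Q) ⊎ J
both-or-failure (inj₁ p) (inj₁ q) = inj₁ (p , q)
both-or-failure (inj₁ _) (inj₂ j) = inj₂ j
both-or-failure (inj₂ j) _        = inj₂ j

true≢false : ¬ (true ≡ false)
true≢false ()

true-or-false : ∀ b → b ≡ true ⊎ b ≡ false
true-or-false true  = inj₁ refl
true-or-false false = inj₂ refl

∧≡true⁺ : ∀ {a b} → a ≡ true → b ≡ true → a ∧ b ≡ true
∧≡true⁺ refl refl = refl

∧≡true⁻ : ∀ {a b} → a ∧ b ≡ true → a ≡ true × b ≡ true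
∧≡true⁻ {true} {true} _ = refl , refl

∨≡true⁺ : ∀ {a b} → a ≡ true ⊎ b ≡ true → a ∨ b ≡ true
∨≡true⁺         (inj₁ refl) = refl
∨≡true⁺ {a = a} (inj₂ refl) = Bool.∨-zeroʳ a

∨≡true⁻ : ∀ {a b} → a ∨ b ≡ true → a ≡ true ⊎ b ≡ true
∨≡true⁻ {true}         _ = inj₁ refl
∨≡true⁻ {false} {true} _ = inj₂ refl

-- Derivations from hypotheses

infix  3 _⊢_
infixl 5 _·_

data _⊢_ (Γ : List Form) : Form → Set where
  hyp : ∀ {φ} → φ ∈ Γ → Γ ⊢ φ
  thm : ∀ {φ} → L φ → Γ ⊢ φ
  _·_ : ∀ {φ ψ} → Γ ⊢ φ ⇒ ψ → Γ ⊢ φ → Γ ⊢ ψ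

⊢-closed : ∀ {φ} → [] ⊢ φ → L φ
⊢-closed (thm d) = d
⊢-closed (d · e) = mp (⊢-closed d) (⊢-closed e)

⊢-weaken : ∀ {Γ Δ φ} → Γ ⊆ Δ → Γ ⊢ φ → Δ ⊢ φ
⊢-weaken Γ⊆Δ (hyp k) = hyp (Γ⊆Δ k)
⊢-weaken Γ⊆Δ (thm d) = thm d
⊢-weaken Γ⊆Δ (d · e) = ⊢-weaken Γ⊆Δ d · ⊢-weaken Γ⊆Δ e

⊢-perm : ∀ {Γ Δ φ} → Γ ↭ Δ → Γ ⊢ φ → Δ ⊢ φ
⊢-perm Γ↭Δ = ⊢-weaken (∈-resp-↭ Γ↭Δ)

L-id : ∀ φ → L (φ ⇒ φ)
L-id φ = mp (mp (ax-S φ (φ ⇒ φ) φ) (ax-K φ (φ ⇒ φ))) (ax-K φ φ)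

⊢-deduction : ∀ {Γ φ ψ} → φ ∷ Γ ⊢ ψ → Γ ⊢ φ ⇒ ψ
⊢-deduction {φ = φ} (hyp (here refl)) = thm (L-id φ)
⊢-deduction         (hyp (there k))   = thm (ax-K _ _) · hyp k
⊢-deduction         (thm d)           = thm (ax-K _ _) · thm d
⊢-deduction         (d · e)           = thm (ax-S _ _ _) · ⊢-deduction d · ⊢-deduction e

module _ {Γ : List Form} {φ ψ : Form} where

  ∧-intro : Γ ⊢ φ → Γ ⊢ ψ → Γ ⊢ φ ∧' ψ
  ∧-intro d e = thm (ax-∧I φ ψ) · d · e

  ∧-elimˡ : Γ ⊢ φ ∧' ψ → Γ ⊢ φ
  ∧-elimˡ d = thm (ax-∧E₁ φ ψ) · d

  ∧-elimʳ : Γ ⊢ φ ∧' ψ → Γ ⊢ ψ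
  ∧-elimʳ d = thm (ax-∧E₂ φ ψ) · d

  ∨-introˡ : Γ ⊢ φ → Γ ⊢ φ ∨' ψ
  ∨-introˡ d = thm (ax-∨I₁ φ ψ) · d

  ∨-introʳ : Γ ⊢ ψ → Γ ⊢ φ ∨' ψ
  ∨-introʳ d = thm (ax-∨I₂ φ ψ) · d

  ∨-elim : ∀ {χ} → Γ ⊢ φ ∨' ψ → φ ∷ Γ ⊢ χ → ψ ∷ Γ ⊢ χ → Γ ⊢ χ
  ∨-elim d e f = thm (ax-∨E _ _ _) · ⊢-deduction e · ⊢-deduction f · d

⊥-elim⊢ : ∀ {Γ φ} → Γ ⊢ ⊥' → Γ ⊢ φ
⊥-elim⊢ d = thm (ax-⊥E _) · d

□-elim : ∀ {Γ φ} → Γ ⊢ □ φ → Γ ⊢ φ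
□-elim d = thm (ax-T _) · d

□-cong : ∀ {φ ψ} → L (φ ⇒ ψ) → L (ψ ⇒ φ) → L (□ φ ⇒ □ ψ)
□-cong φ⇒ψ ψ⇒φ = mp (ax-∧E₁ _ _) (ext (mp (mp (ax-∧I _ _) φ⇒ψ) ψ⇒φ))

⋁ : List Form → Form
⋁ []      = ⊥'
⋁ (φ ∷ Δ) = φ ∨' ⋁ Δ

⋁-intro : ∀ {Γ Δ φ} → φ ∈ Δ → Γ ⊢ φ → Γ ⊢ ⋁ Δ
⋁-intro (here refl) d = ∨-introˡ d
⋁-intro (there k)   d = ∨-introʳ (⋁-intro k d)

⋁-mono : ∀ {Γ Δ Δ′} → Δ ⊆ Δ′ → Γ ⊢ ⋁ Δ → Γ ⊢ ⋁ Δ′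
⋁-mono {Δ = []}    Δ⊆Δ′ d = ⊥-elim⊢ d
⋁-mono {Δ = _ ∷ _} Δ⊆Δ′ d =
  ∨-elim d (⋁-intro (Δ⊆Δ′ (here refl)) (hyp (here refl)))
           (⋁-mono (Δ⊆Δ′ ∘ there) (hyp (here refl)))

⋁-perm : ∀ {Γ Δ Δ′} → Δ ↭ Δ′ → Γ ⊢ ⋁ Δ → Γ ⊢ ⋁ Δ′
⋁-perm Δ↭Δ′ = ⋁-mono (∈-resp-↭ Δ↭Δ′)

⋁-singleton : ∀ {Γ φ} → Γ ⊢ ⋁ (φ ∷ []) → Γ ⊢ φ
⋁-singleton d = ∨-elim d (hyp (here refl)) (⊥-elim⊢ (hyp (here refl)))

-- Subformulas

connective : Form → ℕ
connective (var _)  = 0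
connective ⊥'       = 1
connective (_ ∧' _) = 2
connective (_ ∨' _) = 3
connective (_ ⇒ _)  = 4
connective (□ _)    = 5

infix 4 _≟_

_≟_ : DecidableEquality Form
≟-sameConnective : ∀ φ ψ → connective φ ≡ connective ψ → Dec (φ ≡ ψ)

φ ≟ ψ with connective φ ℕ.≟ connective ψ
... | yes same = ≟-sameConnective φ ψ same
... | no  diff = no (diff ∘ cong connective)

≟-sameConnective (var p)  (var q)  refl = map′ (cong var) (λ { refl → refl }) (p ℕ.≟ q)
≟-sameConnective ⊥'       ⊥'       refl = yes refl
≟-sameConnective (φ ∧' ψ) (χ ∧' ξ) refl =
  map′ (uncurry (cong₂ _∧'_)) (λ { refl → refl , refl }) (φ ≟ χ ×-dec ψ ≟ ξ)
≟-sameConnective (φ ∨' ψ) (χ ∨' ξ) refl =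
  map′ (uncurry (cong₂ _∨'_)) (λ { refl → refl , refl }) (φ ≟ χ ×-dec ψ ≟ ξ)
≟-sameConnective (φ ⇒ ψ)  (χ ⇒ ξ)  refl =
  map′ (uncurry (cong₂ _⇒_)) (λ { refl → refl , refl }) (φ ≟ χ ×-dec ψ ≟ ξ)
≟-sameConnective (□ φ)    (□ ψ)    refl = map′ (cong □) (λ { refl → refl }) (φ ≟ ψ)

sub : Form → List Form
properSub : Form → List Form

sub φ = φ ∷ properSub φ

properSub (var _)  = []
properSub ⊥'       = []
properSub (φ ∧' ψ) = sub φ ++ sub ψ
properSub (φ ∨' ψ) = sub φ ++ sub ψ
properSub (φ ⇒ ψ)  = sub φ ++ sub ψ
properSub (□ φ)    = sub φ

sub-trans : ∀ φ {ψ χ} → ψ ∈ sub φ → χ ∈ sub ψ → χ ∈ sub φ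
properSub-trans : ∀ φ {ψ χ} → ψ ∈ properSub φ → χ ∈ sub ψ → χ ∈ properSub φ
++-sub-trans : ∀ φ ψ {χ ξ} → χ ∈ sub φ ++ sub ψ → ξ ∈ sub χ → ξ ∈ sub φ ++ sub ψ

sub-trans φ (here refl) k = k
sub-trans φ (there k)   m = there (properSub-trans φ k m)

properSub-trans (φ ∧' ψ) = ++-sub-trans φ ψ
properSub-trans (φ ∨' ψ) = ++-sub-trans φ ψ
properSub-trans (φ ⇒ ψ)  = ++-sub-trans φ ψ
properSub-trans (□ φ)    = sub-trans φ

++-sub-trans φ ψ k m with ∈-++⁻ (sub φ) k
... | inj₁ k′ = ∈-++⁺ˡ (sub-trans φ k′ m)
... | inj₂ k′ = ∈-++⁺ʳ (sub φ) (sub-trans ψ k′ m)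

SubformulaClosed : List Form → Set
SubformulaClosed Σ = ∀ {φ} → φ ∈ Σ → sub φ ⊆ Σ

sub-closed : ∀ φ → SubformulaClosed (sub φ)
sub-closed φ k = sub-trans φ k

-- Valuations of a list of formulas

booleans : List Bool
booleans = true ∷ false ∷ []

all-worlds : ∀ n → List (Vec Bool n)
all-worlds zero    = [] ∷ []
all-worlds (suc n) = cartesianProductWith _∷_ booleans (all-worlds n)

∈-all-worlds : ∀ {n} (t : Vec Bool n) → t ∈ all-worlds n
∈-all-worlds []          = here refl
∈-all-worlds (true ∷ t)  = ∈-cartesianProductWith⁺ _∷_ {xs = booleans} (here refl) (∈-all-worlds t)
∈-all-worlds (false ∷ t) = ∈-cartesianProductWith⁺ _∷_ {xs = booleans} (there (here refl)) (∈-all-worlds t)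

World : List Form → Set
World Σ = Vec Bool (length Σ)

infix 4 _≤ʷ_

_≤ʷ_ : ∀ {n} → Vec Bool n → Vec Bool n → Set
_≤ʷ_ = Pointwise Bool._≤_

≤ʷ-antisym : ∀ {n} {T U : Vec Bool n} → T ≤ʷ U → U ≤ʷ T → T ≡ U
≤ʷ-antisym []       []       = refl
≤ʷ-antisym (p ∷ ps) (q ∷ qs) = cong₂ _∷_ (Bool.≤-antisym p q) (≤ʷ-antisym ps qs)

bottom : ∀ n → Vec Bool n
bottom n = replicate n false

bottom-least : ∀ {n} (t : Vec Bool n) → bottom n ≤ʷ t
bottom-least []      = []
bottom-least (b ∷ t) = Bool.≤-minimum b ∷ bottom-least t

-- Only the first occurrence of ψ in Σ is consulted.
member : ∀ Σ → World Σ → Form → Bool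
member []      []      ψ = false
member (φ ∷ Σ) (b ∷ T) ψ = if ⌊ φ ≟ ψ ⌋ then b else member Σ T ψ

positive : ∀ Σ → World Σ → List Form
positive []      []          = []
positive (φ ∷ Σ) (true ∷ T)  = φ ∷ positive Σ T
positive (φ ∷ Σ) (false ∷ T) = positive Σ T

negative : ∀ Σ → World Σ → List Form
negative []      []          = []
negative (φ ∷ Σ) (true ∷ T)  = negative Σ T
negative (φ ∷ Σ) (false ∷ T) = φ ∷ negative Σ T

positive-bottom : ∀ Σ → positive Σ (bottom (length Σ)) ≡ []
positive-bottom []      = refl
positive-bottom (_ ∷ Σ) = positive-bottom Σ

member-mono : ∀ Σ {T U : World Σ} ψ → T ≤ʷ U → member Σ T ψ ≡ true → member Σ U ψ ≡ true
member-mono []      ψ []         ()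
member-mono (φ ∷ Σ) ψ (b≤T ∷ T≤U) e with φ ≟ ψ
... | no  _ = member-mono Σ ψ T≤U e
member-mono (φ ∷ Σ) ψ (b≤b ∷ T≤U) e | yes _ = e
member-mono (φ ∷ Σ) ψ (f≤t ∷ T≤U) e | yes _ = refl

member-∈ : ∀ Σ (T : World Σ) ψ → member Σ T ψ ≡ true → ψ ∈ Σ
member-∈ []      []      ψ ()
member-∈ (φ ∷ Σ) (b ∷ T) ψ e with φ ≟ ψ
... | yes refl = here refl
... | no  _    = there (member-∈ Σ T ψ e)

member-positive : ∀ Σ (T : World Σ) ψ → member Σ T ψ ≡ true → ψ ∈ positive Σ T
member-positive []      []          ψ ()
member-positive (φ ∷ Σ) (b ∷ T)     ψ e with φ ≟ ψ
member-positive (φ ∷ Σ) (true ∷ T)  ψ e  | yes refl = here refl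
member-positive (φ ∷ Σ) (true ∷ T)  ψ e  | no  _    = there (member-positive Σ T ψ e)
member-positive (φ ∷ Σ) (false ∷ T) ψ e  | no  _    = member-positive Σ T ψ e

member-negative : ∀ Σ (T : World Σ) ψ → ψ ∈ Σ → member Σ T ψ ≡ false → ψ ∈ negative Σ T
member-negative (φ ∷ Σ) (b ∷ T)     ψ k           e with φ ≟ ψ
member-negative (φ ∷ Σ) (false ∷ T) ψ k           e | yes refl = here refl
member-negative (φ ∷ Σ) (b ∷ T)     ψ (here refl) e | no  φ≢ψ  = ⊥-elim (φ≢ψ refl)
member-negative (φ ∷ Σ) (true ∷ T)  ψ (there k)   e | no  _    = member-negative Σ T ψ k e
member-negative (φ ∷ Σ) (false ∷ T) ψ (there k)   e | no  _    = there (member-negative Σ T ψ k e)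

-- A formula of Σ that T leaves open is settled by ∨-elimination: either it holds
-- (extensions making it true) or it joins the conclusion (extensions making it false).
⊢-by-extensions : ∀ Σ (T : World Σ) Γ Δ →
                  (∀ t → T ≤ʷ t → positive Σ t ++ Γ ⊢ ⋁ (negative Σ t ++ Δ)) →
                  positive Σ T ++ Γ ⊢ ⋁ Δ
⊢-by-extensions []      []          Γ Δ h = h [] []
⊢-by-extensions (φ ∷ Σ) (true ∷ T)  Γ Δ h =
  ⊢-perm (shift φ _ Γ) (⊢-by-extensions Σ T (φ ∷ Γ) Δ λ t T≤t →
    ⊢-perm (↭-sym (shift φ _ Γ)) (h (true ∷ t) (b≤b ∷ T≤t)))
⊢-by-extensions (φ ∷ Σ) (false ∷ T) Γ Δ h =
  ∨-elim asserted (⊢-perm (shift φ _ Γ) assumed) (hyp (here refl))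
  where
  assumed : positive Σ T ++ φ ∷ Γ ⊢ ⋁ Δ
  assumed = ⊢-by-extensions Σ T (φ ∷ Γ) Δ λ t T≤t →
    ⊢-perm (↭-sym (shift φ _ Γ)) (h (true ∷ t) (f≤t ∷ T≤t))
  asserted : positive Σ T ++ Γ ⊢ φ ∨' ⋁ Δ
  asserted = ⊢-by-extensions Σ T Γ (φ ∷ Δ) λ t T≤t →
    ⋁-perm (↭-sym (shift φ _ Δ)) (h (false ∷ t) (b≤b ∷ T≤t))

-- The canonical model

module Canonical (Σ : List Form) (closed : SubformulaClosed Σ) where

  Σ-∧ˡ : ∀ {φ ψ} → φ ∧' ψ ∈ Σ → φ ∈ Σ
  Σ-∧ˡ k = closed k (there (here refl))

  Σ-∧ʳ : ∀ {φ ψ} → φ ∧' ψ ∈ Σ → ψ ∈ Σ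
  Σ-∧ʳ {φ} k = closed k (there (∈-++⁺ʳ (sub φ) (here refl)))

  Σ-∨ˡ : ∀ {φ ψ} → φ ∨' ψ ∈ Σ → φ ∈ Σ
  Σ-∨ˡ k = closed k (there (here refl))

  Σ-∨ʳ : ∀ {φ ψ} → φ ∨' ψ ∈ Σ → ψ ∈ Σ
  Σ-∨ʳ {φ} k = closed k (there (∈-++⁺ʳ (sub φ) (here refl)))

  Σ-⇒ˡ : ∀ {φ ψ} → (φ ⇒ ψ) ∈ Σ → φ ∈ Σ
  Σ-⇒ˡ k = closed k (there (here refl))

  Σ-⇒ʳ : ∀ {φ ψ} → (φ ⇒ ψ) ∈ Σ → ψ ∈ Σ
  Σ-⇒ʳ {φ} k = closed k (there (∈-++⁺ʳ (sub φ) (here refl)))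

  Σ-□ : ∀ {φ} → □ φ ∈ Σ → φ ∈ Σ
  Σ-□ k = closed k (there (here refl))

  W : Set
  W = World Σ

  infix 5 _∋_
  infix 6 _⁺ _⁻

  _∋_ : W → Form → Bool
  T ∋ ψ = member Σ T ψ

  _⁺ _⁻ : W → List Form
  T ⁺ = positive Σ T
  T ⁻ = negative Σ T

  _≟ʷ_ : DecidableEquality W
  _≟ʷ_ = Vec.≡-dec Bool._≟_

  open DecMembership _≟ʷ_ using (_∈?_)

  Inconsistent : W → Set
  Inconsistent T = T ⁺ ⊢ ⋁ (T ⁻)

  ContainsConsistent : List W → Set
  ContainsConsistent S = ∀ t → t ∉ S → Inconsistent t

  assumed : ∀ {T ψ} → T ∋ ψ ≡ true → T ⁺ ⊢ ψ
  assumed {T} {ψ} e = hyp (member-positive Σ T ψ e)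

  derives-excluded : ∀ {T ψ} → ψ ∈ Σ → T ∋ ψ ≡ false → T ⁺ ⊢ ψ → Inconsistent T
  derives-excluded {T} {ψ} k e = ⋁-intro (member-negative Σ T ψ k e)

  -- Extensions of T outside S are inconsistent; those in S falsify a member of Γ or satisfy ψ.
  ⊢-from-family : ∀ {S} → ContainsConsistent S → ∀ T {Γ ψ} → Γ ⊆ Σ →
                  (∀ t → t ∈ S → T ≤ʷ t → All (λ φ → t ∋ φ ≡ true) Γ → t ∋ ψ ≡ true) →
                  Γ ++ T ⁺ ⊢ ψ
  ⊢-from-family {S} cc T {Γ} {ψ} Γ⊆Σ holds =
    ⊢-perm (++-comm (T ⁺) Γ) (⋁-singleton (⊢-by-extensions Σ T Γ (ψ ∷ []) by-cases))
    where
    by-cases : ∀ t → T ≤ʷ t → t ⁺ ++ Γ ⊢ ⋁ (t ⁻ ++ ψ ∷ [])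
    by-cases t T≤t with t ∈? S
    ... | no t∉S = ⊢-weaken ∈-++⁺ˡ (⋁-mono ∈-++⁺ˡ (cc t t∉S))
    ... | yes t∈S with all-or-any Γ (λ {φ} _ → true-or-false (t ∋ φ))
    ...   | inj₁ Γ-holds = ⋁-intro (∈-++⁺ʳ (t ⁻) (here refl))
                                   (⊢-weaken ∈-++⁺ˡ (assumed (holds t t∈S T≤t Γ-holds)))
    ...   | inj₂ Γ-fails with find Γ-fails
    ...     | φ , φ∈Γ , e = ⋁-intro (∈-++⁺ˡ (member-negative Σ t φ (Γ⊆Σ φ∈Γ) e))
                                    (hyp (∈-++⁺ʳ (t ⁺) φ∈Γ))

  L-from-family : ∀ {S φ ψ} → ContainsConsistent S → φ ∈ Σ →
                  (∀ t → t ∈ S → t ∋ φ ≡ true → t ∋ ψ ≡ true) → L (φ ⇒ ψ)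
  L-from-family {φ = φ} {ψ} cc φ∈Σ holds =
    ⊢-closed (⊢-deduction (subst (λ Γ → φ ∷ Γ ⊢ ψ) (positive-bottom Σ)
      (⊢-from-family cc (bottom _) (λ { (here refl) → φ∈Σ })
        λ { t t∈S _ (e ∷ []) → holds t t∈S e })))

  module Saturation (S : List W) where

    Agree : Form → Form → Set
    Agree φ ψ = All (λ t → t ∋ φ ≡ t ∋ ψ) S

    Refuter : W → Form → Form → Set
    Refuter T φ ψ = Any (λ t → T ≤ʷ t × t ∋ φ ≡ true × t ∋ ψ ≡ false) S

    BoxSeparated : W → Form → Form → Set
    BoxSeparated T φ (□ ψ) = T ∋ □ ψ ≡ true → ¬ Agree φ ψ
    BoxSeparated T φ _     = ⊤

    -- By the □ clause, the truth set of φ is a neighbourhood of T only if □φ ∈ T.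
    SaturatedAt : W → Form → Set
    SaturatedAt T (var _)  = ⊤
    SaturatedAt T ⊥'       = T ∋ ⊥' ≡ false
    SaturatedAt T (φ ∧' ψ) = T ∋ (φ ∧' ψ) ≡ (T ∋ φ) ∧ (T ∋ ψ)
    SaturatedAt T (φ ∨' ψ) = T ∋ (φ ∨' ψ) ≡ (T ∋ φ) ∨ (T ∋ ψ)
    SaturatedAt T (φ ⇒ ψ)  = (T ∋ (φ ⇒ ψ) ≡ true → T ∋ φ ≡ true → T ∋ ψ ≡ true) ×
                             (T ∋ (φ ⇒ ψ) ≡ false → Refuter T φ ψ)
    SaturatedAt T (□ φ)    = (T ∋ □ φ ≡ true → T ∋ φ ≡ true) ×
                             (T ∋ □ φ ≡ false → All (BoxSeparated T φ) Σ)

    Saturated : W → Set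
    Saturated T = All (SaturatedAt T) Σ

    refutes? : ∀ T φ ψ t → Dec (T ≤ʷ t × t ∋ φ ≡ true × t ∋ ψ ≡ false)
    refutes? T φ ψ t =
      Pointwise.decidable Bool._≤?_ T t ×-dec (t ∋ φ Bool.≟ true) ×-dec (t ∋ ψ Bool.≟ false)

    module _ (cc : ContainsConsistent S) where

      ⇒-closed? : ∀ T {φ ψ} → (φ ⇒ ψ) ∈ Σ →
                  (T ∋ (φ ⇒ ψ) ≡ true → T ∋ φ ≡ true → T ∋ ψ ≡ true) ⊎ Inconsistent T
      ⇒-closed? T {φ} {ψ} k with T ∋ (φ ⇒ ψ) in e | T ∋ φ in eφ | T ∋ ψ in eψ
      ... | false | _     | _     = inj₁ λ ()
      ... | true  | false | _     = inj₁ λ _ ()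
      ... | true  | true  | true  = inj₁ λ _ _ → refl
      ... | true  | true  | false = inj₂ (derives-excluded (Σ-⇒ʳ k) eψ (assumed e · assumed eφ))

      ⇒-refuted? : ∀ T {φ ψ} → (φ ⇒ ψ) ∈ Σ →
                   (T ∋ (φ ⇒ ψ) ≡ false → Refuter T φ ψ) ⊎ Inconsistent T
      ⇒-refuted? T {φ} {ψ} k with T ∋ (φ ⇒ ψ) in e
      ... | true  = inj₁ λ ()
      ... | false with Any.any? (refutes? T φ ψ) S
      ...   | yes refuter = inj₁ λ _ → refuter
      ...   | no  none    = inj₂ (derives-excluded k e
                              (⊢-deduction (⊢-from-family cc T (λ { (here refl) → Σ-⇒ˡ k }) holds)))
        where
        holds : ∀ t → t ∈ S → T ≤ʷ t → All (λ χ → t ∋ χ ≡ true) (φ ∷ []) → t ∋ ψ ≡ true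
        holds t t∈S T≤t (eφ ∷ []) with t ∋ ψ in eψ
        ... | true  = refl
        ... | false = ⊥-elim (none (lose t∈S (T≤t , eφ , eψ)))

      □-closed? : ∀ T {φ} → □ φ ∈ Σ → (T ∋ □ φ ≡ true → T ∋ φ ≡ true) ⊎ Inconsistent T
      □-closed? T {φ} k with T ∋ □ φ in e | T ∋ φ in eφ
      ... | false | _     = inj₁ λ ()
      ... | true  | true  = inj₁ λ _ → refl
      ... | true  | false = inj₂ (derives-excluded (Σ-□ k) eφ (□-elim (assumed e)))

      -- If □ψ ∈ T and φ, ψ agree on S, then φ ↔ ψ is provable and extensionality puts □φ in T.
      □-separated? : ∀ T {φ} → □ φ ∈ Σ → T ∋ □ φ ≡ false →
                     ∀ ψ → ψ ∈ Σ → BoxSeparated T φ ψ ⊎ Inconsistent T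
      □-separated? T {φ} k e (□ ψ) k′ with T ∋ □ ψ in eψ
      ... | false = inj₁ λ ()
      ... | true with All.all? (λ t → t ∋ φ Bool.≟ t ∋ ψ) S
      ...   | no  disagree = inj₁ λ _ → disagree
      ...   | yes agree    = inj₂ (derives-excluded k e (thm (□-cong ψ⇒φ φ⇒ψ) · assumed eψ))
        where
        φ⇒ψ : L (φ ⇒ ψ)
        φ⇒ψ = L-from-family cc (Σ-□ k) λ t t∈S eφ → trans (sym (All.lookup agree t∈S)) eφ
        ψ⇒φ : L (ψ ⇒ φ)
        ψ⇒φ = L-from-family cc (Σ-□ k′) λ t t∈S eψ′ → trans (All.lookup agree t∈S) eψ′
      □-separated? T k e (var _)  _ = inj₁ tt
      □-separated? T k e ⊥'       _ = inj₁ tt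
      □-separated? T k e (_ ∧' _) _ = inj₁ tt
      □-separated? T k e (_ ∨' _) _ = inj₁ tt
      □-separated? T k e (_ ⇒ _)  _ = inj₁ tt

      □-refuted? : ∀ T {φ} → □ φ ∈ Σ →
                   (T ∋ □ φ ≡ false → All (BoxSeparated T φ) Σ) ⊎ Inconsistent T
      □-refuted? T {φ} k with T ∋ □ φ in e
      ... | true  = inj₁ λ ()
      ... | false with all-or-failure Σ (λ {ψ} k′ → □-separated? T k e ψ k′)
      ...   | inj₁ separated    = inj₁ λ _ → separated
      ...   | inj₂ inconsistent = inj₂ inconsistent

      saturatedAt? : ∀ T ψ → ψ ∈ Σ → SaturatedAt T ψ ⊎ Inconsistent T
      saturatedAt? T (var _) k = inj₁ tt
      saturatedAt? T ⊥' k with T ∋ ⊥' in e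
      ... | false = inj₁ refl
      ... | true  = inj₂ (⊥-elim⊢ (assumed e))
      saturatedAt? T (φ ∧' ψ) k with T ∋ (φ ∧' ψ) in e | T ∋ φ in eφ | T ∋ ψ in eψ
      ... | true  | true  | true  = inj₁ refl
      ... | true  | false | _     = inj₂ (derives-excluded (Σ-∧ˡ k) eφ (∧-elimˡ (assumed e)))
      ... | true  | true  | false = inj₂ (derives-excluded (Σ-∧ʳ k) eψ (∧-elimʳ (assumed e)))
      ... | false | true  | true  = inj₂ (derives-excluded k e (∧-intro (assumed eφ) (assumed eψ)))
      ... | false | false | _     = inj₁ refl
      ... | false | true  | false = inj₁ refl
      saturatedAt? T (φ ∨' ψ) k with T ∋ (φ ∨' ψ) in e | T ∋ φ in eφ | T ∋ ψ in eψ
      ... | true  | true  | _     = inj₁ refl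
      ... | true  | false | true  = inj₁ refl
      ... | true  | false | false = inj₂ (∨-elim (assumed e)
                                      (⋁-intro (member-negative Σ T φ (Σ-∨ˡ k) eφ) (hyp (here refl)))
                                      (⋁-intro (member-negative Σ T ψ (Σ-∨ʳ k) eψ) (hyp (here refl))))
      ... | false | true  | _     = inj₂ (derives-excluded k e (∨-introˡ (assumed eφ)))
      ... | false | false | true  = inj₂ (derives-excluded k e (∨-introʳ (assumed eψ)))
      ... | false | false | false = inj₁ refl
      saturatedAt? T (φ ⇒ ψ) k = both-or-failure (⇒-closed? T k) (⇒-refuted? T k)
      saturatedAt? T (□ φ)   k = both-or-failure (□-closed? T k) (□-refuted? T k)

      saturated? : ∀ T → Saturated T ⊎ Inconsistent T
      saturated? T = all-or-failure Σ (λ {ψ} → saturatedAt? T ψ)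

  open Saturation using (Saturated; saturated?)

  record SaturatedFamily : Set where
    field
      worlds              : List W
      contains-consistent : ContainsConsistent worlds
      saturated           : All (Saturated worlds) worlds

  remove : W → List W → List W
  remove T = filter (λ t → ¬? (t ≟ʷ T))

  remove-shortens : ∀ {T S} → T ∈ S → suc (length (remove T S)) ≤ length S
  remove-shortens {T} {S} T∈S =
    filter-notAll (λ t → ¬? (t ≟ʷ T)) S (Any.map (λ { refl T≢T → T≢T refl }) T∈S)

  remove-inconsistent : ∀ {T S} → Inconsistent T → ContainsConsistent S → ContainsConsistent (remove T S)
  remove-inconsistent {T} inconsistent cc t t∉ with t ≟ʷ T
  ... | yes refl = inconsistent
  ... | no  t≢T  = cc t λ t∈S → t∉ (∈-filter⁺ (λ t → ¬? (t ≟ʷ T)) t∈S t≢T)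

  prune : ∀ n S → length S ≤ n → ContainsConsistent S → SaturatedFamily
  prune zero    []      _     cc = record { worlds = [] ; contains-consistent = cc ; saturated = [] }
  prune (suc n) S       |S|≤n cc with all-or-any S (λ {T} _ → saturated? S cc T)
  ... | inj₁ saturated = record { worlds = S ; contains-consistent = cc ; saturated = saturated }
  ... | inj₂ unsaturated with find unsaturated
  ...   | T , T∈S , inconsistent =
    prune n (remove T S) (s≤s⁻¹ (≤-trans (remove-shortens T∈S) |S|≤n))
            (remove-inconsistent inconsistent cc)

  family : SaturatedFamily
  family = prune _ (all-worlds _) ≤-refl λ t t∉ → ⊥-elim (t∉ (∈-all-worlds t))

  open SaturatedFamily family
  open Saturation worlds using (SaturatedAt)

  saturatedAt : ∀ {T ψ} → T ∈ worlds → ψ ∈ Σ → SaturatedAt T ψ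
  saturatedAt T∈ k = All.lookup (All.lookup saturated T∈) k

  -- The remaining candidate worlds stay in the carrier, so that it is a plain type,
  -- but are inert: above any world there is nothing but itself and the family.
  infix 4 _≤ᶜ_

  _≤ᶜ_ : W → W → Set
  T ≤ᶜ U = T ≡ U ⊎ (T ≤ʷ U × U ∈ worlds)

  ≤ᶜ⇒≤ʷ : ∀ {T U} → T ≤ᶜ U → T ≤ʷ U
  ≤ᶜ⇒≤ʷ (inj₁ refl)       = Pointwise.refl Bool.≤-refl
  ≤ᶜ⇒≤ʷ (inj₂ (T≤U , _)) = T≤U

  ≤ᶜ-family : ∀ {T U} → T ∈ worlds → T ≤ᶜ U → U ∈ worlds
  ≤ᶜ-family T∈ (inj₁ refl)      = T∈
  ≤ᶜ-family _  (inj₂ (_ , U∈)) = U∈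

  ≤ᶜ-trans : ∀ {T U V} → T ≤ᶜ U → U ≤ᶜ V → T ≤ᶜ V
  ≤ᶜ-trans (inj₁ refl)       U≤V                = U≤V
  ≤ᶜ-trans (inj₂ T≤U)        (inj₁ refl)        = inj₂ T≤U
  ≤ᶜ-trans (inj₂ (T≤U , _))  (inj₂ (U≤V , V∈)) = inj₂ (Pointwise.trans Bool.≤-trans T≤U U≤V , V∈)

  ≤ᶜ-antisym : ∀ {T U} → T ≤ᶜ U → U ≤ᶜ T → T ≡ U
  ≤ᶜ-antisym (inj₁ T≡U)        _                 = T≡U
  ≤ᶜ-antisym (inj₂ _)          (inj₁ U≡T)        = sym U≡T
  ≤ᶜ-antisym (inj₂ (T≤U , _))  (inj₂ (U≤T , _)) = ≤ʷ-antisym T≤U U≤T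

  ≤ᶜ-isPartialOrder : IsPartialOrder _≡_ _≤ᶜ_
  ≤ᶜ-isPartialOrder = record
    { isPreorder = record
      { isEquivalence = ≡.isEquivalence
      ; reflexive     = inj₁
      ; trans         = ≤ᶜ-trans
      }
    ; antisym = ≤ᶜ-antisym
    }

  Neighbourhood : W → (W → Set) → Set
  Neighbourhood T X =
    ∃[ ψ ] T ∋ □ ψ ≡ true × (∀ z → z ∈ worlds → (X z → z ∋ ψ ≡ true) × (z ∋ ψ ≡ true → X z))

  canonicalFrame : PNFrame
  canonicalFrame = record
    { W      = W
    ; N      = Neighbourhood
    ; _≤_    = _≤ᶜ_
    ; isPO   = ≤ᶜ-isPartialOrder
    ; N-ext  = λ X⊆Y Y⊆X (ψ , eψ , agree) →
        ψ , eψ , λ z z∈ → proj₁ (agree z z∈) ∘ Y⊆X z , X⊆Y z ∘ proj₂ (agree z z∈)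
    ; N-mono = λ T≤U _ (ψ , eψ , agree) → ψ , member-mono Σ (□ ψ) (≤ᶜ⇒≤ʷ T≤U) eψ , agree
    }

  canonicalModel : PNModel
  canonicalModel = record
    { frame  = canonicalFrame
    ; V      = λ q T → T ∋ var q ≡ true
    ; V-mono = λ {q} e T≤U → member-mono Σ (var q) (≤ᶜ⇒≤ʷ T≤U) e
    }

  infix 3 _⊩ᶜ_

  _⊩ᶜ_ : W → Form → Set
  _⊩ᶜ_ = _⊩_ canonicalModel

  Truth : Form → W → Set
  Truth ψ T = (T ⊩ᶜ ψ → T ∋ ψ ≡ true) × (T ∋ ψ ≡ true → T ⊩ᶜ ψ)

  truth : ∀ ψ → ψ ∈ Σ → ∀ T → T ∈ worlds → Truth ψ T
  truth (var q)  k T T∈ = (λ e → e) , (λ e → e)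
  truth ⊥'       k T T∈ = (λ ()) , λ e → ⊥-elim (true≢false (trans (sym e) (saturatedAt T∈ k)))
  truth (φ ∧' ψ) k T T∈ =
    (λ (⊩φ , ⊩ψ) → trans ∧-sat (∧≡true⁺ (proj₁ φ-truth ⊩φ) (proj₁ ψ-truth ⊩ψ))) ,
    λ e → let eφ , eψ = ∧≡true⁻ (trans (sym ∧-sat) e) in proj₂ φ-truth eφ , proj₂ ψ-truth eψ
    where
    ∧-sat : SaturatedAt T (φ ∧' ψ)
    ∧-sat = saturatedAt T∈ k
    φ-truth : Truth φ T
    φ-truth = truth φ (Σ-∧ˡ k) T T∈
    ψ-truth : Truth ψ T
    ψ-truth = truth ψ (Σ-∧ʳ k) T T∈
  truth (φ ∨' ψ) k T T∈ =
    (λ ⊩φ∨ψ → trans ∨-sat (∨≡true⁺ (Sum.map (proj₁ φ-truth) (proj₁ ψ-truth) ⊩φ∨ψ))) ,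
    λ e → Sum.map (proj₂ φ-truth) (proj₂ ψ-truth) (∨≡true⁻ (trans (sym ∨-sat) e))
    where
    ∨-sat : SaturatedAt T (φ ∨' ψ)
    ∨-sat = saturatedAt T∈ k
    φ-truth : Truth φ T
    φ-truth = truth φ (Σ-∨ˡ k) T T∈
    ψ-truth : Truth ψ T
    ψ-truth = truth ψ (Σ-∨ʳ k) T T∈
  truth (φ ⇒ ψ) k T T∈ = forced⇒member , member⇒forced
    where
    φ-truth : ∀ t → t ∈ worlds → Truth φ t
    φ-truth = truth φ (Σ-⇒ˡ k)
    ψ-truth : ∀ t → t ∈ worlds → Truth ψ t
    ψ-truth = truth ψ (Σ-⇒ʳ k)
    forced⇒member : T ⊩ᶜ φ ⇒ ψ → T ∋ (φ ⇒ ψ) ≡ true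
    forced⇒member ⊩φ⇒ψ with T ∋ (φ ⇒ ψ) in e
    ... | true  = refl
    ... | false with find (proj₂ (saturatedAt T∈ k) e)
    ...   | t , t∈ , T≤t , eφ , eψ = ⊥-elim (true≢false (trans (sym (proj₁ (ψ-truth t t∈) ⊩ψ)) eψ))
      where
      ⊩ψ : t ⊩ᶜ ψ
      ⊩ψ = ⊩φ⇒ψ t (inj₂ (T≤t , t∈)) (proj₂ (φ-truth t t∈) eφ)
    member⇒forced : T ∋ (φ ⇒ ψ) ≡ true → T ⊩ᶜ φ ⇒ ψ
    member⇒forced e U T≤U ⊩φ =
      proj₂ (ψ-truth U U∈) (proj₁ (saturatedAt U∈ k) eU (proj₁ (φ-truth U U∈) ⊩φ))
      where
      U∈ : U ∈ worlds
      U∈ = ≤ᶜ-family T∈ T≤U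
      eU : U ∋ (φ ⇒ ψ) ≡ true
      eU = member-mono Σ (φ ⇒ ψ) (≤ᶜ⇒≤ʷ T≤U) e
  truth (□ φ) k T T∈ = forced⇒member , member⇒forced
    where
    φ-truth : ∀ t → t ∈ worlds → Truth φ t
    φ-truth = truth φ (Σ-□ k)
    forced⇒member : T ⊩ᶜ □ φ → T ∋ □ φ ≡ true
    forced⇒member (⊩φ , ψ , eψ , agree) with T ∋ □ φ in e
    ... | true  = refl
    ... | false = ⊥-elim (All.lookup (proj₂ (saturatedAt T∈ k) e) (member-∈ Σ T (□ ψ) eψ) eψ
                    (All.tabulate λ {t} t∈ → Bool.⇔→≡ (mk⇔
                      (proj₁ (agree t t∈) ∘ proj₂ (φ-truth t t∈))
                      (proj₁ (φ-truth t t∈) ∘ proj₂ (agree t t∈)))))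
    member⇒forced : T ∋ □ φ ≡ true → T ⊩ᶜ □ φ
    member⇒forced e = proj₂ (φ-truth T T∈) (proj₁ (saturatedAt T∈ k) e) , φ , e , φ-truth

  complete : ∀ {φ} → φ ∈ Σ → PN-valid φ → L φ
  complete {φ} φ∈Σ valid =
    ⊢-closed (subst (_⊢ φ) (positive-bottom Σ)
      (⊢-from-family contains-consistent (bottom _) (λ ()) λ t t∈ _ _ →
        proj₁ (truth φ φ∈Σ t t∈) (valid canonicalModel t)))

mainTheorem3 : ∀ (φ : Form) → PN-valid φ → L φ
mainTheorem3 φ = Canonical.complete (sub φ) (sub-closed φ) (here refl)
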